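{- Let $f:F\to F'$ be a conjugation-preserving morphism of tracts and $\mathcal M$ a strong $F$-matroid on a finite set $E$. Then $\mathcal V(f_*(\mathcal M))\supseteq\{\alpha f(X):\ X\in\mathcal V(\mathcal M),\ \alpha\in F'-\{0\}\}$.
   Context: A tract is a multiplicative group $G$ with $N_G\subseteq\mathbb N[G]$ such that $0\in N_G$, $1\notin N_G$, there is a unique $\eta\in G$ with $1+\eta\in N_G$, and $N_G$ is closed under multiplication by $G$; $F=G\cup\{0\}$, $-g=\eta g$, $\boxplus_ja_j=\{b:-b+\sum_ja_j\in N_G\}$, extended componentwise to $F^E$. Each tract has a conjugation $x\mapsto x^c$ (involutive automorphism). Inner product $X\cdot Y=\sum_eX(e)Y(e)^c\in\mathbb N[G]$; $X\perp Y$ iff $X\cdot Y\in N_G$; $S^\perp$ = vectors orthogonal to all of $S$; $\mathrm{Minsupp}(S)$ = elements of $S$ of minimal support. A morphism of tracts $(G,N_G)\to(G',N_{G'})$ is a group homomorphism $f:G\to G'$ such that the induced map $\mathbb N[G]\to\mathbb N[G']$, $\sum a_jg_j\mapsto\sum a_jf(g_j)$, sends $N_G$ into $N_{G'}$; it is extended by $f(0)=0$ and componentwise to $F^E$; it is conjugation-preserving if $f(x^c)=f(x)^c$. A strong $F$-matroid $\mathcal M$ on $E$ is given by its set $\mathcal C(\mathcal M)\subseteq F^E$ of $F$-circuits satisfying: $\mathbf 0\notin\mathcal C$; $G\mathcal C=\mathcal C$; if $\underline X\subseteq\underline Y$ for $X,Y\in\mathcal C$ then $X\in GY$; and strong modular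 elimination (for a modular family $\{X_1,\dots,X_k,X\}\subseteq\mathcal C$ with $\underline X\not\subseteq\bigcup\underline{X_j}$ and $e_j\in(\underline X\cap\underline{X_j})\setminus\bigcup_{l\neq j}\underline{X_l}$, $X(e_j)=-X_j(e_j)$, there is $Z\in\mathcal C\cap(X\boxplus\boxplus_jX_j)$ with $Z(e_j)=0$ for all $j$; modular means the supports are atoms of the lattice of unions of circuit supports whose join has height equal to the family size). Its $F$-cocircuits are $\mathcal C^*(\mathcal M)=\mathrm{Minsupp}(\mathcal C(\mathcal M)^\perp-\{\mathbf 0\})$, and its $F$-vectors are $\mathcal V(\mathcal M)=\mathcal C^*(\mathcal M)^\perp$. By Baker–Bowler, a conjugation-preserving morphism $f$ induces a strong $F'$-matroid $f_*(\mathcal M)$ with $\mathcal C(f_*(\mathcal M))=\{\alpha f(X):X\in\mathcal C(\mathcal M),\alpha\in F'-\{0\}\}$ and $\mathcal C^*(f_*(\mathcal M))=\{\alpha f(X):X\in\mathcal C^*(\mathcal M),\alpha\in F'-\{0\}\}$. -}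

module Defs where

open import Level using (Level)
open import Data.Nat using (ℕ; zero; suc; _≤_)
open import Data.Fin using (Fin)
open import Data.Fin.Subset using (Subset; _∈_; _∉_; _⊆_; _⊂_; ⊥; ⋃)
open import Data.Vec using (tabulate)
open import Data.Maybe using (Maybe; just; nothing; is-just)
import Data.Maybe as Maybe
open import Data.List using (List; []; _∷_; map; catMaybes; allFin)
open import Data.List.Relation.Binary.Permutation.Propositional using (_↭_)
open import Data.Product using (Σ; ∃; _×_; _,_)
open import Relation.Nullary using (¬_)
open import Relation.Binary.PropositionalEquality using (_≡_; _≢_)

-- An element of ℕ[G] (a finite formal sum of group elements) is encoded
-- as a list of group elements; N is required to be invariant under
-- permutation, so only the underlying multiset matters.

record Tract : Set₁ where
  field
    G          : Set
    _·_        : G → G → G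
    one        : G
    inv        : G → G
    ·-assoc    : ∀ x y z → (x · y) · z ≡ x · (y · z)
    ·-comm     : ∀ x y → x · y ≡ y · x
    ·-identityˡ : ∀ x → one · x ≡ x
    ·-inverseˡ : ∀ x → inv x · x ≡ one
    N          : List G → Set
    N-perm     : ∀ {xs ys} → xs ↭ ys → N xs → N ys
    N-zero     : N []
    N-one      : ¬ N (one ∷ [])
    η          : G
    N-η        : N (one ∷ η ∷ [])
    η-unique   : ∀ g → N (one ∷ g ∷ []) → g ≡ η
    N-mult     : ∀ g xs → N xs → N (map (g ·_) xs)
    conj       : G → G
    conj-hom   : ∀ x y → conj (x · y) ≡ conj x · conj y
    conj-invol : ∀ x → conj (conj x) ≡ x
    conj-N     : ∀ xs → N xs → N (map conj xs)

record Morphism (T T' : Tract) : Set where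
  private
    module T  = Tract T
    module T' = Tract T'
  field
    fun   : T.G → T'.G
    hom   : ∀ x y → fun (x T.· y) ≡ fun x T'.· fun y
    N-map : ∀ xs → T.N xs → T'.N (map fun xs)

ConjugationPreserving : {T T' : Tract} → Morphism T T' → Set
ConjugationPreserving {T} {T'} f =
  ∀ x → Morphism.fun f (Tract.conj T x) ≡ Tract.conj T' (Morphism.fun f x)

-- F = G ∪ {0}  (0 = nothing), vectors in F^E with E = Fin n.

module _ (T : Tract) where
  open Tract T

  F : Set
  F = Maybe G

  _*F_ : F → F → F
  just x *F just y = just (x · y)
  _      *F _      = nothing

  conjF : F → F
  conjF = Maybe.map conj

  -- -b = η b  (and -0 = 0)
  negF : F → F
  negF = Maybe.map (η ·_)

  Vector : ℕ → Set
  Vector n = Fin n → F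

  zeroV : ∀ {n} → Vector n
  zeroV _ = nothing

  scale : ∀ {n} → G → Vector n → Vector n
  scale α X e = just α *F X e

  _≐_ : ∀ {n} → Vector n → Vector n → Set
  X ≐ Y = ∀ e → X e ≡ Y e

  supp : ∀ {n} → Vector n → Subset n
  supp X = tabulate (λ e → is-just (X e))

  NonZeroV : ∀ {n} → Vector n → Set
  NonZeroV X = ∃ λ e → e ∈ supp X

  -- inner product X · Y = Σ_e X(e) Y(e)^c ∈ ℕ[G] (zero terms dropped)
  inner : ∀ {n} → Vector n → Vector n → List G
  inner {n} X Y = catMaybes (map (λ e → X e *F conjF (Y e)) (allFin n))

  _⊥V_ : ∀ {n} → Vector n → Vector n → Set
  X ⊥V Y = N (inner X Y)

  Perp : ∀ {n} → (Vector n → Set) → Vector n → Set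
  Perp S Y = ∀ X → S X → Y ⊥V X

  Minsupp : ∀ {n} → (Vector n → Set) → Vector n → Set
  Minsupp S X = S X × (∀ Y → S Y → supp Y ⊆ supp X → supp X ⊆ supp Y)

  -- b ∈ ⊞ as  iff  -b + Σ as ∈ N_G
  InHypersum : F → List F → Set
  InHypersum b as = N (catMaybes (negF b ∷ as))

  module _ {n : ℕ} (C : Vector n → Set) where

    IsUnionOfCircuits : Subset n → Set
    IsUnionOfCircuits U =
      ∀ e → e ∈ U → ∃ λ X → C X × e ∈ supp X × supp X ⊆ U

    data Chain : Subset n → ℕ → Set where
      base : Chain ⊥ 0
      step : ∀ {U V h} → IsUnionOfCircuits V → Chain U h → U ⊂ V → Chain V (suc h)

    HasHeight : Subset n → ℕ → Set
    HasHeight U h = Chain U h × (∀ h' → Chain U h' → h' ≤ h)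

  record StrongMatroid (n : ℕ) : Set₁ where
    field
      circuit : Vector n → Set
      zero∉     : ¬ circuit zeroV
      G-closed  : ∀ α X → circuit X → circuit (scale α X)
      support   : ∀ X Y → circuit X → circuit Y → supp X ⊆ supp Y →
                  ∃ λ α → X ≐ scale α Y
      strong-modular-elimination :
        ∀ (k : ℕ) (Xs : Fin k → Vector n) (X : Vector n) →
        circuit X → (∀ j → circuit (Xs j)) →
        -- modularity: the join of the k+1 supports has height k+1
        HasHeight circuit (⋃ (supp X ∷ map (λ j → supp (Xs j)) (allFin k))) (suc k) →
        ¬ (supp X ⊆ ⋃ (map (λ j → supp (Xs j)) (allFin k))) →
        (es : Fin k → Fin n) →
        (∀ j → es j ∈ supp X) →
        (∀ j → es j ∈ supp (Xs j)) →
        (∀ j l → j ≢ l → es j ∉ supp (Xs l)) →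
        (∀ j → X (es j) ≡ negF (Xs j (es j))) →
        ∃ λ Z → circuit Z
              × (∀ e → InHypersum (Z e) (X e ∷ map (λ j → Xs j e) (allFin k)))
              × (∀ j → Z (es j) ≡ nothing)

  cocircuit : ∀ {n} → StrongMatroid n → Vector n → Set
  cocircuit M = Minsupp (λ Y → Perp (StrongMatroid.circuit M) Y × NonZeroV Y)

  vectorOf : ∀ {n} → StrongMatroid n → Vector n → Set
  vectorOf M = Perp (cocircuit M)

mapV : {T T' : Tract} → Morphism T T' → ∀ {n} → Vector T n → Vector T' n
mapV f X e = Maybe.map (Morphism.fun f) (X e)

Push : {T T' : Tract} → Morphism T T' → ∀ {n} →
       (Vector T n → Set) → Vector T' n → Set
Push {T} {T'} f S Y = ∃ λ X → ∃ λ α → S X × _≐_ T' Y (scale T' α (mapV f X))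

module Submission where

open import Defs
open import Algebra.Bundles using (CommutativeSemigroup)
import Algebra.Properties.CommutativeSemigroup as CommutativeSemigroupProperties
open import Data.Nat using (ℕ)
open import Data.Product using (_×_; _,_)
open import Data.Maybe using (just; nothing)
import Data.Maybe as Maybe
open import Data.List using (List; map; catMaybes; allFin)
open import Data.List.Properties using (map-catMaybes; map-∘; map-cong)
open import Function using (_∘′_)
open import Relation.Binary.PropositionalEquality
open ≡-Reasoning

-- Push-forward preserves orthogonality: the inner product of α f(X) and γ f(Z) is
-- α γᶜ f(X · Z), and N is stable under f and under multiplication by α γᶜ.
-- Cocircuits of f_*(M) are push-forwards of cocircuits of M, so vectors go to vectors.

·-commutativeSemigroup : Tract → CommutativeSemigroup _ _
·-commutativeSemigroup T = record
  { isCommutativeSemigroup = record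
    { isSemigroup = record
      { isMagma = record { isEquivalence = isEquivalence ; ∙-cong = cong₂ _·_ }
      ; assoc   = ·-assoc
      }
    ; comm = ·-comm
    }
  }
  where open Tract T

catMaybes-map-map : {A B C : Set} (k : B → C) (g : A → Maybe.Maybe B) (xs : List A) →
  catMaybes (map (Maybe.map k ∘′ g) xs) ≡ map k (catMaybes (map g xs))
catMaybes-map-map k g xs = begin
  catMaybes (map (Maybe.map k ∘′ g) xs)   ≡⟨ cong catMaybes (map-∘ xs) ⟩
  catMaybes (map (Maybe.map k) (map g xs)) ≡⟨ map-catMaybes k (map g xs) ⟨
  map k (catMaybes (map g xs))             ∎

module _ {T T' : Tract} (f : Morphism T T') (f-conj : ConjugationPreserving f) where
  open Tract T
  module T' = Tract T'
  open Morphism f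
  open CommutativeSemigroupProperties (·-commutativeSemigroup T') using (interchange)

  *F-conj-scale-map : ∀ α γ (x z : F T) →
    _*F_ T' (_*F_ T' (just α) (Maybe.map fun x)) (conjF T' (_*F_ T' (just γ) (Maybe.map fun z)))
      ≡ Maybe.map (λ g → (α T'.· T'.conj γ) T'.· fun g) (_*F_ T x (conjF T z))
  *F-conj-scale-map α γ nothing  z        = refl
  *F-conj-scale-map α γ (just x) nothing  = refl
  *F-conj-scale-map α γ (just x) (just z) = cong just (begin
    (α T'.· fun x) T'.· T'.conj (γ T'.· fun z)              ≡⟨ cong ((α T'.· fun x) T'.·_) (T'.conj-hom γ (fun z)) ⟩
    (α T'.· fun x) T'.· (T'.conj γ T'.· T'.conj (fun z))    ≡⟨ interchange α (fun x) (T'.conj γ) (T'.conj (fun z)) ⟩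
    (α T'.· T'.conj γ) T'.· (fun x T'.· T'.conj (fun z))    ≡⟨ cong (λ w → (α T'.· T'.conj γ) T'.· (fun x T'.· w)) (f-conj z) ⟨
    (α T'.· T'.conj γ) T'.· (fun x T'.· fun (conj z))       ≡⟨ cong ((α T'.· T'.conj γ) T'.·_) (hom x (conj z)) ⟨
    (α T'.· T'.conj γ) T'.· fun (x · conj z)                ∎)

  inner-scale-map : ∀ {n} α γ (X Z : Vector T n) →
    inner T' (scale T' α (mapV f X)) (scale T' γ (mapV f Z))
      ≡ map ((α T'.· T'.conj γ) T'.·_) (map fun (inner T X Z))
  inner-scale-map {n} α γ X Z = begin
    inner T' (scale T' α (mapV f X)) (scale T' γ (mapV f Z))
      ≡⟨ cong catMaybes (map-cong (λ e → *F-conj-scale-map α γ (X e) (Z e)) (allFin n)) ⟩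
    catMaybes (map (λ e → Maybe.map k (_*F_ T (X e) (conjF T (Z e)))) (allFin n))
      ≡⟨ catMaybes-map-map k _ (allFin n) ⟩
    map k (inner T X Z)
      ≡⟨ map-∘ (inner T X Z) ⟩
    map ((α T'.· T'.conj γ) T'.·_) (map fun (inner T X Z)) ∎
    where
    k : G → T'.G
    k g = (α T'.· T'.conj γ) T'.· fun g

  ⊥V-scale-map : ∀ {n} α γ (X Z : Vector T n) → _⊥V_ T X Z →
    _⊥V_ T' (scale T' α (mapV f X)) (scale T' γ (mapV f Z))
  ⊥V-scale-map α γ X Z X⊥Z =
    subst T'.N (sym (inner-scale-map α γ X Z))
      (T'.N-mult (α T'.· T'.conj γ) _ (N-map _ X⊥Z))

inner-cong : (T : Tract) {n : ℕ} {X X' Z Z' : Vector T n} →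
  _≐_ T X X' → _≐_ T Z Z' → inner T X Z ≡ inner T X' Z'
inner-cong T {n} X≐X' Z≐Z' =
  cong catMaybes (map-cong (λ e → cong₂ (λ x z → _*F_ T x (conjF T z)) (X≐X' e) (Z≐Z' e)) (allFin n))

proposition4p5 :
    (T T' : Tract) (f : Morphism T T') → ConjugationPreserving f →
    (n : ℕ) (M : StrongMatroid T n) →
    (M' : StrongMatroid T' n) →
    (∀ Y → (StrongMatroid.circuit M' Y → Push f (StrongMatroid.circuit M) Y)
         × (Push f (StrongMatroid.circuit M) Y → StrongMatroid.circuit M' Y)) →
    (∀ Y → cocircuit T' M' Y → Push f (cocircuit T M) Y) →
    ∀ Y → Push f (vectorOf T M) Y → vectorOf T' M' Y
proposition4p5 T T' f f-conj n M M' _ cocircuit-push Y (X , α , X-vector , Y≐αfX) W W-cocircuit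
  with cocircuit-push W W-cocircuit
... | Z , γ , Z-cocircuit , W≐γfZ =
  subst (Tract.N T') (sym (inner-cong T' Y≐αfX W≐γfZ))
    (⊥V-scale-map f f-conj α γ X Z (X-vector Z Z-cocircuit))
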